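{- Let $b\ge 2$ and $k\ge 0$ be integers, and let $p$ be a node of $T_b(\infty)$ with $p_0=p_1=\dots=p_{k-1}=0$ and $p_k>b-1$. Then $p$ is the root of an $X_{b,k+1}$ subtree of $T_b(\infty)$.
   Context: A $b$-ary partition of $n\ge0$ is a sequence $p=(p_0,p_1,\dots)$ of non-negative integers, finitely many nonzero, with $\sum_j p_jb^j=n$. For such $p$, let $l(p)$ be the largest $l\ge0$ with $p_0=\dots=p_{l-1}=b-1$, and for $0\le i\le l(p)$ let $\mathrm{inc}_i(p)=(0,\dots,0,p_i+1,p_{i+1},\dots)$ ($i$ leading zeros). The ordered rooted tree $T_b(\infty)$ has as nodes all $b$-ary partitions of all $n\ge0$, root $(0,0,\dots)$, and each node $p$ has exactly $l(p)+1$ ordered sons, the $(i+1)$-th being $\mathrm{inc}_i(p)$. For a node $p$, its rightmost branch is $v_1=p$, $v_{m+1}=$ last son of $v_m$. For $m\ge1$, $c_b(m)$ is the largest $k$ such that $b^k$ divides $m$. For $k\ge1$, $X_{b,k}$ is the ordered rooted tree (unique up to isomorphism, being determined level by level) whose rightmost branch $v_1,v_2,\dots$ satisfies: for each $1\le i\le b^{k-1}$, $v_i$ has exactly $c_b(i)+1$ sons, the last being $v_{i+1}$, and for $1\le l\le c_b(i)$ the subtree rooted at its $l$-th son is isomorphic to $X_{b,l}$; and the subtree rooted at $v_{b^{k-1}+1}$ is isomorphic to $X_{b,k}$. (So $X_{b,1}$ is an infinite chain.) A node $p$ of $T_b(\infty)$ is the root of an $X_{b,k}$ subtree if the subtree of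 $T_b(\infty)$ consisting of $p$ and all its descendants is isomorphic, as an ordered rooted tree, to $X_{b,k}$. -}

module Defs where

open import Data.Nat using (ℕ; zero; suc; _∸_; _^_; _≡ᵇ_; _<ᵇ_; _/_)
open import Data.Nat.Divisibility using (_∣?_)
open import Data.Bool using (if_then_else_)
open import Data.List using (List; []; _∷_; map; _++_; [_]; upTo; applyUpTo)
open import Data.List.Relation.Binary.Pointwise using (Pointwise)
open import Data.Product using (Σ; _×_; _,_)
open import Relation.Nullary using (does)

record OTree : Set₁ where
  field
    Node : Set
    sons : Node → List Node
open OTree public

-- The subtree of T rooted at x is isomorphic (as an ordered rooted tree) to
-- the subtree of U rooted at y: there is a relation containing (x , y) under
-- which related nodes have son lists of equal length, related positionwise.
Iso : (T U : OTree) → Node T → Node U → Set₁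
Iso T U x y =
  Σ (Node T → Node U → Set) λ R →
    R x y × (∀ a c → R a c → Pointwise R (sons T a) (sons U c))

-- The tree T_b(∞).  A b-ary partition p is represented by a list
-- (p_0, p_1, ..., p_r); entries beyond the list are 0.

at : List ℕ → ℕ → ℕ
at []       _       = 0
at (x ∷ xs) zero    = x
at (x ∷ xs) (suc j) = at xs j

lead : ℕ → List ℕ → ℕ
lead b []       = 0
lead b (x ∷ xs) = if x ≡ᵇ (b ∸ 1) then suc (lead b xs) else 0

inc : ℕ → List ℕ → List ℕ
inc zero    []       = 1 ∷ []
inc zero    (x ∷ xs) = suc x ∷ xs
inc (suc i) []       = 0 ∷ inc i []
inc (suc i) (x ∷ xs) = 0 ∷ inc i xs

T : ℕ → OTree
T b = record
  { Node = List ℕ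
  ; sons = λ p → map (λ i → inc i p) (upTo (suc (lead b p)))
  }

cbAux : ℕ → ℕ → ℕ → ℕ
cbAux b' zero    m = 0
cbAux b' (suc f) m =
  if does (suc (suc b') ∣? m)
  then suc (cbAux b' f (m / suc (suc b')))
  else 0

cb : ℕ → ℕ → ℕ
cb zero          m = 0
cb (suc zero)    m = 0
cb (suc (suc b')) m = cbAux b' m m

-- Node (m , i) stands for v_i on the rightmost branch of
-- a copy of X_{b,m} (1 ≤ i ≤ b^(m-1)); its sons are the roots (l , 1) of
-- copies of X_{b,l} for l = 1 .. c_b(i), followed by v_{i+1}, where
-- v_{b^(m-1)+1} is identified with the root (m , 1) of X_{b,m}.

X : ℕ → OTree
X b = record
  { Node = ℕ × ℕ
  ; sons = λ { (m , i) →
      map (λ l → (l , 1)) (applyUpTo suc (cb b i))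
      ++ [ (m , (if i <ᵇ b ^ (m ∸ 1) then suc i else 1)) ] }
  }

Xroot : ℕ → ℕ × ℕ
Xroot k = (k , 1)

IsXRoot : ℕ → ℕ → List ℕ → Set₁
IsXRoot b k p = Iso (T b) (X b) p (Xroot k)

-- Read p_0 … p_{n-1} (all < b) as the base-b digits of a number v, where p_n ≥ b is the
-- first entry that is not a digit.  Such a node corresponds to the node v_{v+1} on the
-- rightmost branch of X_{b,n+1}.  Its sons inc_i p with i < l(p) again start with a big
-- entry p_i + 1 = b after i zeros, so they are roots of X_{b,i+1}; and l(p) is exactly
-- c_b(v+1), the number of trailing carries when adding 1 to v.  The last son inc_{l(p)} p
-- is the base-b successor v+1, unless all n digits are b-1: then v+1 = b^n and the last
-- son is 0…0(p_n+1)…, the root of X_{b,n+1} again.  The hypothesis of the theorem says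
-- that p itself corresponds to v_1 of X_{b,k+1}.
module Submission where

open import Data.Nat using (ℕ; _≤_; _<_; _+_; _∸_)
open import Data.List using (List)
open import Relation.Binary.PropositionalEquality using (_≡_)
open import Defs

open import Data.Bool using (if_then_else_)
open import Data.Nat using (zero; suc; _*_; _^_; _<ᵇ_; _/_; z≤n; s≤s; s≤s⁻¹; z<s)
open import Data.Nat.Properties
open import Data.Nat.Divisibility using (_∣_; _∣?_; ∣m+n∣m⇒∣n; ∣⇒≤; m∣m*n)
open import Data.Nat.DivMod using (m*n/n≡m)
open import Data.List using ([]; _∷_; _++_; [_]; applyUpTo; length; replicate; drop)
open import Data.List.Properties using (length-replicate; length-++-≤ˡ; map-upTo; map-applyUpTo)
open import Data.List.Relation.Unary.All using (All; []; _∷_)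
open import Data.List.Relation.Unary.All.Properties using (replicate⁺)
open import Data.List.Relation.Binary.Pointwise using (Pointwise; []; _∷_)
open import Function using (_∘′_)
open import Data.Product using (_×_; _,_)
open import Data.Sum using (inj₁; inj₂)
open import Relation.Binary.PropositionalEquality using (_≢_; refl; sym; trans; cong; cong₂; subst; subst₂; module ≡-Reasoning)
open import Relation.Nullary using (¬_; yes; no)
open import Relation.Nullary.Decidable using (dec-true; dec-false)

pointwise-applyUpTo-++ : ∀ {A B : Set} {R : A → B → Set} (f : ℕ → A) (g : ℕ → B) y n →
  (∀ j → j < n → R (f j) (g j)) → R (f n) y →
  Pointwise R (applyUpTo f (suc n)) (applyUpTo g n ++ [ y ])
pointwise-applyUpTo-++ f g y zero     _     Rfn = Rfn ∷ []
pointwise-applyUpTo-++ f g y (suc n) Rfg Rfn =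
  Rfg 0 z<s ∷ pointwise-applyUpTo-++ (f ∘′ suc) (g ∘′ suc) y n (λ j j<n → Rfg (suc j) (s≤s j<n)) Rfn

if-<ᵇ : ∀ {A : Set} {x y : A} {m n} → m < n → (if m <ᵇ n then x else y) ≡ x
if-<ᵇ {x = x} {y} {m} {n} m<n = cong (if_then x else y) (dec-true (m <? n) m<n)

if-<ᵇ-refl : ∀ {A : Set} {x y : A} n → (if n <ᵇ n then x else y) ≡ y
if-<ᵇ-refl {x = x} {y} n = cong (if_then x else y) (dec-false (n <? n) (<-irrefl refl))

inc-< : ∀ j q → j < length q → inc j q ≡ replicate j 0 ++ suc (at q j) ∷ drop (suc j) q
inc-< zero    (y ∷ ys) _         = refl
inc-< (suc j) (y ∷ ys) (s≤s j<n) = cong (0 ∷_) (inc-< j ys j<n)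

inc-++ : ∀ j ds ys → j < length ds → inc j (ds ++ ys) ≡ inc j ds ++ ys
inc-++ zero    (d ∷ ds) ys _         = refl
inc-++ (suc j) (d ∷ ds) ys (s≤s j<n) = cong (0 ∷_) (inc-++ j ds ys j<n)

length-inc : ∀ j ds → j < length ds → length (inc j ds) ≡ length ds
length-inc zero    (d ∷ ds) _         = refl
length-inc (suc j) (d ∷ ds) (s≤s j<n) = cong suc (length-inc j ds j<n)

inc-length-++ : ∀ ds {x} ys → inc (length ds) (ds ++ x ∷ ys) ≡ replicate (length ds) 0 ++ suc x ∷ ys
inc-length-++ []       ys = refl
inc-length-++ (d ∷ ds) ys = cong (0 ∷_) (inc-length-++ ds ys)

≡-replicate-0-++ : ∀ k p → (∀ j → j < k → at p j ≡ 0) → 0 < at p k →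
  p ≡ replicate k 0 ++ at p k ∷ drop (suc k) p
≡-replicate-0-++ zero    (y ∷ ys) _      _ = refl
≡-replicate-0-++ (suc k) (y ∷ ys) zeros pos =
  cong₂ _∷_ (zeros 0 z<s) (≡-replicate-0-++ k ys (λ j j<k → zeros (suc j) (s≤s j<k)) pos)

module Radix (b' : ℕ) where

  b : ℕ
  b = suc (suc b')

  Digits : List ℕ → Set
  Digits = All (_< b)

  value : List ℕ → ℕ
  value []       = 0
  value (d ∷ ds) = d + b * value ds

  lead-∷-max : ∀ ds → lead b (suc b' ∷ ds) ≡ suc (lead b ds)
  lead-∷-max ds = cong (if_then suc (lead b ds) else 0) (dec-true (suc b' ≟ suc b') refl)

  lead-∷-nonmax : ∀ {d} ds → d ≢ suc b' → lead b (d ∷ ds) ≡ 0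
  lead-∷-nonmax {d} ds d≢ = cong (if_then suc (lead b ds) else 0) (dec-false (d ≟ suc b') d≢)

  lead≤length : ∀ ds → lead b ds ≤ length ds
  lead≤length []       = z≤n
  lead≤length (d ∷ ds) with d ≟ suc b'
  ... | yes refl = subst (_≤ suc (length ds)) (sym (lead-∷-max ds)) (s≤s (lead≤length ds))
  ... | no d≢    = subst (_≤ suc (length ds)) (sym (lead-∷-nonmax ds d≢)) z≤n

  lead-++-big : ∀ ds {x} ys → b ≤ x → lead b (ds ++ x ∷ ys) ≡ lead b ds
  lead-++-big [] {x} ys b≤x = lead-∷-nonmax ys (λ x≡ → <-irrefl (sym x≡) b≤x)
  lead-++-big (d ∷ ds) ys b≤x with d ≟ suc b'
  ... | yes refl = begin
    lead b (suc b' ∷ ds ++ _ ∷ ys) ≡⟨ lead-∷-max (ds ++ _ ∷ ys) ⟩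
    suc (lead b (ds ++ _ ∷ ys))    ≡⟨ cong suc (lead-++-big ds ys b≤x) ⟩
    suc (lead b ds)                ≡⟨ lead-∷-max ds ⟨
    lead b (suc b' ∷ ds)           ∎
    where open ≡-Reasoning
  ... | no d≢ = trans (lead-∷-nonmax (ds ++ _ ∷ ys) d≢) (sym (lead-∷-nonmax ds d≢))

  at-<lead : ∀ ds ys j → j < lead b ds → at (ds ++ ys) j ≡ suc b'
  at-<lead (d ∷ ds) ys j j<l with d ≟ suc b'
  at-<lead (d ∷ ds) ys zero    j<l | yes d≡ = d≡
  at-<lead (d ∷ ds) ys (suc j) j<l | yes refl =
    at-<lead ds ys j (s≤s⁻¹ (subst (suc j <_) (lead-∷-max ds) j<l))
  ... | no d≢ with () ← subst (j <_) (lead-∷-nonmax ds d≢) j<l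

  suc-nonmax-digit : ∀ {d} → d < b → d ≢ suc b' → suc d < b
  suc-nonmax-digit d<b d≢ = s≤s (≤∧≢⇒< (s≤s⁻¹ d<b) d≢)

  value-replicate-0 : ∀ j → value (replicate j 0) ≡ 0
  value-replicate-0 zero    = refl
  value-replicate-0 (suc j) = trans (cong (b *_) (value-replicate-0 j)) (*-zeroʳ b)

  value<b^length : ∀ ds → Digits ds → value ds < b ^ length ds
  value<b^length []       []           = z<s
  value<b^length (d ∷ ds) (d<b ∷ dsᵈ) = begin-strict
    d + b * value ds   <⟨ +-monoˡ-< (b * value ds) d<b ⟩
    b + b * value ds   ≡⟨ *-suc b (value ds) ⟨
    b * suc (value ds) ≤⟨ *-monoʳ-≤ b (value<b^length ds dsᵈ) ⟩
    b * b ^ length ds  ∎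
    where open ≤-Reasoning

  suc-value-max : ∀ ds → lead b ds ≡ length ds → suc (value ds) ≡ b ^ length ds
  suc-value-max []       _ = refl
  suc-value-max (d ∷ ds) l≡ with d ≟ suc b'
  ... | yes refl = trans (sym (*-suc b (value ds)))
    (cong (b *_) (suc-value-max ds (suc-injective (trans (sym (lead-∷-max ds)) l≡))))
  ... | no d≢ with () ← trans (sym (lead-∷-nonmax ds d≢)) l≡

  inc-lead-Digits : ∀ ds → Digits ds → lead b ds < length ds → Digits (inc (lead b ds) ds)
  inc-lead-Digits (d ∷ ds) (d<b ∷ dsᵈ) l< with d ≟ suc b'
  ... | yes refl = subst (λ l → Digits (inc l (suc b' ∷ ds))) (sym (lead-∷-max ds))
    (z<s ∷ inc-lead-Digits ds dsᵈ (s≤s⁻¹ (subst (_< suc (length ds)) (lead-∷-max ds) l<)))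
  ... | no d≢    = subst (λ l → Digits (inc l (d ∷ ds))) (sym (lead-∷-nonmax ds d≢))
    (suc-nonmax-digit d<b d≢ ∷ dsᵈ)

  value-inc-lead : ∀ ds → lead b ds < length ds → value (inc (lead b ds) ds) ≡ suc (value ds)
  value-inc-lead (d ∷ ds) l< with d ≟ suc b'
  ... | yes refl = begin
    value (inc (lead b (suc b' ∷ ds)) (suc b' ∷ ds))
      ≡⟨ cong (λ l → value (inc l (suc b' ∷ ds))) (lead-∷-max ds) ⟩
    b * value (inc (lead b ds) ds)                   ≡⟨ cong (b *_) (value-inc-lead ds l<′) ⟩
    b * suc (value ds)                               ≡⟨ *-suc b (value ds) ⟩
    b + b * value ds                                 ∎
    where
      open ≡-Reasoning
      l<′ : lead b ds < length ds
      l<′ = s≤s⁻¹ (subst (_< suc (length ds)) (lead-∷-max ds) l<)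
  ... | no d≢ = cong (λ l → value (inc l (d ∷ ds))) (lead-∷-nonmax ds d≢)

  cbAux-∣ : ∀ f {n} → b ∣ n → cbAux b' (suc f) n ≡ suc (cbAux b' f (n / b))
  cbAux-∣ f {n} b∣n = cong (if_then suc (cbAux b' f (n / b)) else 0) (dec-true (b ∣? n) b∣n)

  cbAux-∤ : ∀ f {n} → ¬ b ∣ n → cbAux b' (suc f) n ≡ 0
  cbAux-∤ f {n} b∤n = cong (if_then suc (cbAux b' f (n / b)) else 0) (dec-false (b ∣? n) b∤n)

  ∤*+ : ∀ v {r} → suc r < b → ¬ b ∣ b * v + suc r
  ∤*+ v r<b b∣ = <-irrefl refl (<-≤-trans r<b (∣⇒≤ (∣m+n∣m⇒∣n b∣ (m∣m*n v))))

  cbAux-suc-value : ∀ f ds → Digits ds → suc (value ds) ≤ f →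
    cbAux b' f (suc (value ds)) ≡ lead b ds
  cbAux-suc-value (suc f) [] [] _ =
    cbAux-∤ f (∤*+ 0 (s≤s (s≤s z≤n)) ∘′ subst (b ∣_) (cong (_+ 1) (sym (*-zeroʳ b))))
  cbAux-suc-value (suc f) (d ∷ ds) (d<b ∷ dsᵈ) (s≤s v<f) with d ≟ suc b'
  ... | yes refl = begin
    cbAux b' (suc f) (b + b * v)      ≡⟨ cong (cbAux b' (suc f)) (*-suc b v) ⟨
    cbAux b' (suc f) (b * suc v)      ≡⟨ cbAux-∣ f (m∣m*n (suc v)) ⟩
    suc (cbAux b' f (b * suc v / b))  ≡⟨ cong (suc ∘′ cbAux b' f) b*sucv/b ⟩
    suc (cbAux b' f (suc v))          ≡⟨ cong suc (cbAux-suc-value f ds dsᵈ (≤-trans sucv≤ v<f)) ⟩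
    suc (lead b ds)                   ≡⟨ lead-∷-max ds ⟨
    lead b (suc b' ∷ ds)              ∎
    where
      open ≡-Reasoning
      v = value ds
      b*sucv/b : b * suc v / b ≡ suc v
      b*sucv/b = trans (cong (_/ b) (*-comm b (suc v))) (m*n/n≡m (suc v) b)
      sucv≤ : suc v ≤ suc b' + b * v
      sucv≤ = +-mono-≤ (s≤s (z≤n {b'})) (m≤n*m v b)
  ... | no d≢ = trans
    (cbAux-∤ f (∤*+ (value ds) (suc-nonmax-digit d<b d≢)
                ∘′ subst (b ∣_) (+-comm (suc d) (b * value ds))))
    (sym (lead-∷-nonmax ds d≢))

  cb-suc-value : ∀ ds → Digits ds → cb b (suc (value ds)) ≡ lead b ds
  cb-suc-value ds dsᵈ = cbAux-suc-value (suc (value ds)) ds dsᵈ ≤-refl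

  data Corresponds : List ℕ → ℕ × ℕ → Set where
    split : ∀ ds {x} ys → Digits ds → b ≤ x →
            Corresponds (ds ++ x ∷ ys) (suc (length ds) , suc (value ds))

  corresponds-zeros : ∀ j {x} ys → b ≤ x → Corresponds (replicate j 0 ++ x ∷ ys) (suc j , 1)
  corresponds-zeros j ys b≤x =
    subst₂ (λ n i → Corresponds (replicate j 0 ++ _ ∷ ys) (suc n , suc i))
      (length-replicate j) (value-replicate-0 j)
      (split (replicate j 0) ys (replicate⁺ j z<s) b≤x)

  corresponds-inc-<lead : ∀ ds {x} ys j → j < lead b ds →
    Corresponds (inc j (ds ++ x ∷ ys)) (suc j , 1)
  corresponds-inc-<lead ds {x} ys j j<l =
    subst (λ q′ → Corresponds q′ (suc j , 1)) (sym (inc-< j q j<length))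
      (corresponds-zeros j (drop (suc j) q) (≤-reflexive (cong suc (sym (at-<lead ds _ j j<l)))))
    where
      q = ds ++ x ∷ ys
      j<length : j < length q
      j<length = <-≤-trans j<l (≤-trans (lead≤length ds) (length-++-≤ˡ ds))

  corresponds-inc-lead : ∀ ds {x} ys → Digits ds → b ≤ x →
    Corresponds (inc (lead b ds) (ds ++ x ∷ ys))
      (suc (length ds) , (if suc (value ds) <ᵇ b ^ length ds then suc (suc (value ds)) else 1))
  corresponds-inc-lead ds {x} ys dsᵈ b≤x with m≤n⇒m<n∨m≡n (lead≤length ds)
  ... | inj₁ l<n =
    subst₂ Corresponds (sym (inc-++ l ds (x ∷ ys) l<n)) (cong₂ _,_ length≡ index≡)
      (split (inc l ds) ys (inc-lead-Digits ds dsᵈ l<n) b≤x)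
    where
      l = lead b ds
      length≡ : suc (length (inc l ds)) ≡ suc (length ds)
      length≡ = cong suc (length-inc l ds l<n)
      suc-value< : suc (value ds) < b ^ length ds
      suc-value< = subst₂ (λ v n → v < b ^ n) (value-inc-lead ds l<n) (length-inc l ds l<n)
        (value<b^length (inc l ds) (inc-lead-Digits ds dsᵈ l<n))
      index≡ : suc (value (inc l ds)) ≡ (if suc (value ds) <ᵇ b ^ length ds then suc (suc (value ds)) else 1)
      index≡ = trans (cong suc (value-inc-lead ds l<n)) (sym (if-<ᵇ suc-value<))
  ... | inj₂ l≡n =
    subst₂ Corresponds (sym inc≡) (cong (suc (length ds) ,_) (sym index≡))
      (corresponds-zeros (length ds) ys (m≤n⇒m≤1+n b≤x))
    where
      inc≡ : inc (lead b ds) (ds ++ x ∷ ys) ≡ replicate (length ds) 0 ++ suc x ∷ ys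
      inc≡ = trans (cong (λ l → inc l (ds ++ x ∷ ys)) l≡n) (inc-length-++ ds ys)
      index≡ : (if suc (value ds) <ᵇ b ^ length ds then suc (suc (value ds)) else 1) ≡ 1
      index≡ = trans (cong (λ i → if i <ᵇ b ^ length ds then suc i else 1) (suc-value-max ds l≡n))
                     (if-<ᵇ-refl (b ^ length ds))

  corresponds-sons : ∀ q c → Corresponds q c → Pointwise Corresponds (sons (T b) q) (sons (X b) c)
  corresponds-sons _ _ (split ds {x} ys dsᵈ b≤x)
    rewrite map-upTo (λ i → inc i (ds ++ x ∷ ys)) (suc (lead b (ds ++ x ∷ ys)))
          | map-applyUpTo suc (λ l → (l , 1)) (cb b (suc (value ds)))
          | lead-++-big ds ys b≤x
          | cb-suc-value ds dsᵈ
    = pointwise-applyUpTo-++ _ _ _ (lead b ds)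
        (corresponds-inc-<lead ds ys) (corresponds-inc-lead ds ys dsᵈ b≤x)

proposition3 : (b k : ℕ) (p : List ℕ) → 2 ≤ b →
    (∀ j → j < k → at p j ≡ 0) → b ∸ 1 < at p k →
    IsXRoot b (k + 1) p
proposition3 (suc (suc b')) k p (s≤s (s≤s z≤n)) zeros big =
  Corresponds , p-corresponds , corresponds-sons
  where
    open Radix b'
    p-corresponds : Corresponds p (k + 1 , 1)
    p-corresponds = subst₂ Corresponds
      (sym (≡-replicate-0-++ k p zeros (<-≤-trans z<s big)))
      (cong (_, 1) (+-comm 1 k))
      (corresponds-zeros k (drop (suc k) p) big)
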